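{- For every positive integer $n$, \[ \sum_{k=0}^{n}\Big(-\frac{1}{4}\Big)^k\binom{n}{k}\binom{1+2k}{k}\,k^2H_{1+2k} =\frac{3n(2-3n)}{(3-2n)(1-4n^2)4^n}\binom{1+2n}{n}\Big\{2H_{1+2n}-\frac{3}{2}H_n-\frac{3-8n-12n^2}{1-4n^2}+\frac{9+n(3-25n+6n^2)}{3n(3-2n)(2-3n)}\Big\}-\frac{1}{1+n}. \]
   Context: For a nonnegative integer $m$, the harmonic number $H_m$ is defined by $H_0=0$ and $H_m=\sum_{i=1}^m \frac{1}{i}$ for $m\ge 1$. -}

module Defs where

open import Data.Nat using (ℕ; zero; suc)
open import Data.Integer using (+_)
open import Data.Rational using (ℚ; 0ℚ; 1ℚ; _+_; _*_; _/_; 1/_; ≢-nonZero)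
open import Data.Rational.Properties using (_≟_)
open import Relation.Nullary using (yes; no)

ℕ→ℚ : ℕ → ℚ
ℕ→ℚ n = + n / 1

_^ℚ_ : ℚ → ℕ → ℚ
q ^ℚ zero  = 1ℚ
q ^ℚ suc k = q * (q ^ℚ k)

-- total inverse (convention 0⁻¹ = 0); only applied to nonzero values below
inv : ℚ → ℚ
inv q with q ≟ 0ℚ
... | yes _ = 0ℚ
... | no q≢0 = 1/_ q {{≢-nonZero q≢0}}

H : ℕ → ℚ
H zero    = 0ℚ
H (suc m) = H m + (+ 1 / suc m)

Σ[0≤k≤_] : ℕ → (ℕ → ℚ) → ℚ
Σ[0≤k≤ zero ] f  = f zero
Σ[0≤k≤ suc n ] f = Σ[0≤k≤ n ] f + f (suc n)

module Submission where

-- Let s n be the left-hand side.  Zeilberger's algorithm, run with the harmonic number H (1 + 2k)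
-- carried along as a non-hypergeometric factor, gives the first-order recurrence
--   a(n) s(n+1) + b(n) s(n) = 3(n+1) - W(n+1),
-- where W m = Σ_j C(m,j) (-1/4)^j C(2j,j) w(m,j) collects the increments of the harmonic numbers.
-- Gosper's algorithm evaluates W m as a rational multiple of T m = Σ_j C(m,j) (-1/4)^j C(2j,j),
-- which Zeilberger's algorithm identifies as C(2m,m) / 4^m.  The right-hand side of the theorem is
-- g n V n - 1/(n+1), where g solves the homogeneous recurrence and V n is the bracket.  Since
-- a(n)/(n+2) + b(n)/(n+1) = -3(n+1), variation of constants reduces the recurrence for it to
-- b(n) g(n) (V(n+1) - V(n)) = W(n+1), a polynomial identity once denominators are cleared.
-- Both sides agree at n = 1, and a(n) ≠ 0 for n ≥ 1.

open import Defs
open import Data.Nat using (ℕ; zero; suc; NonZero)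
import Data.Nat as ℕ
import Data.Nat.Properties as ℕ
open import Data.Nat.Combinatorics using (_C_; k>n⇒nCk≡0)
open import Relation.Binary.PropositionalEquality

open ≡-Reasoning

module _ where

  open import Data.Nat using (_+_; _*_; s≤s)
  open import Data.Nat.Properties using (+-comm; +-identityʳ; *-distribˡ-+; *-zeroʳ; *-identityˡ; *-identityʳ; *-suc;
    m+n∸m≡n; m≤m+n)
  open import Data.Nat.Combinatorics using (nC1≡n; nCk+nC[k+1]≡[n+1]C[k+1]; nCk≡nC[n∸k])
  open import Data.Nat.Tactic.RingSolver using (solve-∀)

  C-absorption : ∀ n k → suc k * (suc n C suc k) ≡ suc n * (n C k)
  C-absorption zero    zero    = refl
  C-absorption zero    (suc k) = *-zeroʳ (suc (suc k))
  C-absorption (suc n) zero    = trans (*-identityˡ _) (trans (nC1≡n (suc (suc n))) (sym (*-identityʳ _)))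
  C-absorption (suc n) (suc k) = begin
      suc (suc k) * (suc (suc n) C suc (suc k))
    ≡⟨ cong (suc (suc k) *_) (sym (nCk+nC[k+1]≡[n+1]C[k+1] (suc n) (suc k))) ⟩
      suc (suc k) * (suc n C suc k + suc n C suc (suc k))
    ≡⟨ regroup (suc n C suc k) (suc n C suc (suc k)) k ⟩
      suc k * (suc n C suc k) + suc n C suc k + suc (suc k) * (suc n C suc (suc k))
    ≡⟨ cong₂ (λ u v → u + suc n C suc k + v) (C-absorption n k) (C-absorption n (suc k)) ⟩
      suc n * (n C k) + suc n C suc k + suc n * (n C suc k)
    ≡⟨ factor (n C k) (n C suc k) (suc n C suc k) n ⟩
      suc n * (n C k + n C suc k) + suc n C suc k
    ≡⟨ cong (λ u → suc n * u + suc n C suc k) (nCk+nC[k+1]≡[n+1]C[k+1] n k) ⟩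
      suc n * (suc n C suc k) + suc n C suc k
    ≡⟨ +-comm (suc n * (suc n C suc k)) (suc n C suc k) ⟩
      suc (suc n) * (suc n C suc k)
    ∎
    where
    regroup : ∀ a b k → suc (suc k) * (a + b) ≡ suc k * a + a + suc (suc k) * b
    regroup = solve-∀
    factor : ∀ a b c n → suc n * a + c + suc n * b ≡ suc n * (a + b) + c
    factor = solve-∀

  C-upper-shift : ∀ n k → suc n * (n C k) + k * (suc n C k) ≡ suc n * (suc n C k)
  C-upper-shift n zero    = +-identityʳ (suc n * 1)
  C-upper-shift n (suc k) = begin
      suc n * (n C suc k) + suc k * (suc n C suc k)
    ≡⟨ cong (suc n * (n C suc k) +_) (C-absorption n k) ⟩
      suc n * (n C suc k) + suc n * (n C k)
    ≡⟨ +-comm (suc n * (n C suc k)) (suc n * (n C k)) ⟩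
      suc n * (n C k) + suc n * (n C suc k)
    ≡⟨ sym (*-distribˡ-+ (suc n) (n C k) (n C suc k)) ⟩
      suc n * (n C k + n C suc k)
    ≡⟨ cong (suc n *_) (nCk+nC[k+1]≡[n+1]C[k+1] n k) ⟩
      suc n * (suc n C suc k)
    ∎

  C-lower-shift : ∀ n k → suc k * (n C suc k) + k * (n C k) ≡ n * (n C k)
  C-lower-shift zero    zero    = refl
  C-lower-shift zero    (suc k) = cong₂ _+_ (*-zeroʳ (suc (suc k))) (*-zeroʳ (suc k))
  C-lower-shift (suc n) k       =
    trans (cong (_+ k * (suc n C k)) (C-absorption n k)) (C-upper-shift n k)

  central-sym : ∀ k → suc (2 * k) C suc k ≡ suc (2 * k) C k
  central-sym k = trans (nCk≡nC[n∸k] (s≤s (m≤m+n k (k + 0))))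
                        (cong (suc (2 * k) C_) (trans (m+n∸m≡n k (k + 0)) (+-identityʳ k)))

  central-double : ∀ k → (2 * suc k) C suc k ≡ 2 * (suc (2 * k) C k)
  central-double k = begin
      (2 * suc k) C suc k
    ≡⟨ cong (_C suc k) (*-suc 2 k) ⟩
      suc (suc (2 * k)) C suc k
    ≡⟨ sym (nCk+nC[k+1]≡[n+1]C[k+1] (suc (2 * k)) k) ⟩
      suc (2 * k) C k + suc (2 * k) C suc k
    ≡⟨ cong (suc (2 * k) C k +_) (central-sym k) ⟩
      suc (2 * k) C k + suc (2 * k) C k
    ≡⟨ cong (suc (2 * k) C k +_) (sym (+-identityʳ _)) ⟩
      2 * (suc (2 * k) C k)
    ∎

  central-absorption : ∀ k → suc k * (suc (2 * k) C k) ≡ suc (2 * k) * ((2 * k) C k)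
  central-absorption k = trans (cong (suc k *_) (sym (central-sym k))) (C-absorption (2 * k) k)

open import Data.Nat.Divisibility using (_∣_; _∣?_; divides)
open import Data.Nat.Coprimality using (1-coprimeTo) renaming (sym to coprime-sym)
open import Data.Integer using (+_; -[1+_])
import Data.Integer as ℤ
import Data.Integer.Properties as ℤₚ
open import Data.Rational using (ℚ; mkℚ; 0ℚ; 1ℚ; _+_; _*_; _-_; -_; _/_; ↥_; ≢-nonZero)
open import Data.Rational.Properties using (_≟_; +-*-commutativeRing; normalize-coprime; *-inverseʳ;
  *-assoc; *-comm; *-identityʳ; *-zeroˡ; +-identityʳ; +-identityˡ; +-assoc; +-comm)
open import Data.Empty using (⊥-elim; ⊥-elim-irr)
open import Relation.Nullary using (¬_; yes; no)
open import Relation.Nullary.Decidable using (dec⇒maybe; from-no)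
open import Tactic.RingSolver.Core.AlmostCommutativeRing using (AlmostCommutativeRing; fromCommutativeRing)
open import Tactic.RingSolver using (solve-∀)

-- Numeric literals are overloaded only inside this module: in the statement of theorem12, an
-- overloaded denominator would make the search for its NonZero instance commit to the hypothesis
-- NonZero n and fail.
module _ where

  open import Agda.Builtin.FromNat using (Number; fromNat)
  open import Data.Unit using (⊤; tt)
  import Data.Nat.Literals as ℕ-Literals
  import Data.Rational.Literals as ℚ-Literals

  instance
    ℕ-number : Number ℕ
    ℕ-number = ℕ-Literals.number
    ℚ-number : Number ℚ
    ℚ-number = ℚ-Literals.number
    literal-constraint : ⊤
    literal-constraint = tt

  -- solve-∀ treats defined names as opaque constants, so the polynomial identities below spell
  -- out (or rebind in a let) the polynomials they are about.
  ℚ-ring : AlmostCommutativeRing _ _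
  ℚ-ring = fromCommutativeRing +-*-commutativeRing (λ x → dec⇒maybe (0ℚ ≟ x))

  inv-inverseʳ : ∀ {x} → x ≢ 0ℚ → x * inv x ≡ 1ℚ
  inv-inverseʳ {x} x≢0 with x ≟ 0ℚ
  ... | yes x≡0 = ⊥-elim (x≢0 x≡0)
  ... | no  x≢0′ = *-inverseʳ x {{≢-nonZero x≢0′}}

  *-inv-cancelʳ : ∀ {m} x → m ≢ 0ℚ → x * m * inv m ≡ x
  *-inv-cancelʳ {m} x m≢0 = begin
      x * m * inv m    ≡⟨ *-assoc x m (inv m) ⟩
      x * (m * inv m)  ≡⟨ cong (x *_) (inv-inverseʳ m≢0) ⟩
      x * 1ℚ           ≡⟨ *-identityʳ x ⟩
      x                ∎

  *-cancelˡ : ∀ {m x y} → m ≢ 0ℚ → m * x ≡ m * y → x ≡ y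
  *-cancelˡ {m} {x} {y} m≢0 mx≡my = begin
      x              ≡⟨ *-inv-cancelʳ x m≢0 ⟨
      x * m * inv m  ≡⟨ cong (_* inv m) (trans (*-comm x m) (trans mx≡my (*-comm m y))) ⟩
      y * m * inv m  ≡⟨ *-inv-cancelʳ y m≢0 ⟩
      y              ∎

  *-≢0 : ∀ {x y} → x ≢ 0ℚ → y ≢ 0ℚ → x * y ≢ 0ℚ
  *-≢0 {x} {y} x≢0 y≢0 xy≡0 = x≢0 (begin
      x              ≡⟨ *-inv-cancelʳ x y≢0 ⟨
      x * y * inv y  ≡⟨ cong (_* inv y) xy≡0 ⟩
      0ℚ * inv y     ≡⟨ *-zeroˡ (inv y) ⟩
      0ℚ             ∎)

  difference≡0⇒≡ : ∀ {x y} → x - y ≡ 0ℚ → x ≡ y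
  difference≡0⇒≡ {x} {y} x-y≡0 = begin
      x             ≡⟨ split x y ⟩
      (x - y) + y   ≡⟨ cong (_+ y) x-y≡0 ⟩
      0ℚ + y        ≡⟨ +-identityˡ y ⟩
      y             ∎
    where
    split : ∀ x y → x ≡ (x - y) + y
    split = solve-∀ ℚ-ring

  ≡-sub : ∀ {a b c} → a + b ≡ c → a ≡ c - b
  ≡-sub {a} {b} {c} a+b≡c = trans (cancel a b) (cong (_- b) a+b≡c)
    where
    cancel : ∀ a b → a ≡ a + b - b
    cancel = solve-∀ ℚ-ring

  ℕ→ℚ≡mkℚ : ∀ n → ℕ→ℚ n ≡ mkℚ (+ n) 0 (coprime-sym (1-coprimeTo n))
  ℕ→ℚ≡mkℚ n = normalize-coprime (coprime-sym (1-coprimeTo n))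

  ℕ→ℚ-suc : ∀ n → ℕ→ℚ (suc n) ≡ ℕ→ℚ n + 1
  ℕ→ℚ-suc n rewrite ℕ→ℚ≡mkℚ n = cong (_/ 1) numerator
    where
    numerator : + suc n ≡ + n ℤ.* + 1 ℤ.+ + 1 ℤ.* + 1
    numerator = trans (cong +_ (ℕ.+-comm 1 n)) (cong (ℤ._+ + 1) (sym (ℤₚ.*-identityʳ (+ n))))

  ℕ→ℚ-+ : ∀ m n → ℕ→ℚ (m ℕ.+ n) ≡ ℕ→ℚ m + ℕ→ℚ n
  ℕ→ℚ-+ zero    n = sym (+-identityˡ (ℕ→ℚ n))
  ℕ→ℚ-+ (suc m) n = begin
      ℕ→ℚ (suc (m ℕ.+ n))        ≡⟨ ℕ→ℚ-suc (m ℕ.+ n) ⟩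
      ℕ→ℚ (m ℕ.+ n) + 1          ≡⟨ cong (_+ 1) (ℕ→ℚ-+ m n) ⟩
      ℕ→ℚ m + ℕ→ℚ n + 1          ≡⟨ swap (ℕ→ℚ m) (ℕ→ℚ n) ⟩
      (ℕ→ℚ m + 1) + ℕ→ℚ n        ≡⟨ cong (_+ ℕ→ℚ n) (ℕ→ℚ-suc m) ⟨
      ℕ→ℚ (suc m) + ℕ→ℚ n        ∎
    where
    swap : ∀ x y → x + y + 1 ≡ (x + 1) + y
    swap = solve-∀ ℚ-ring

  ℕ→ℚ-* : ∀ m n → ℕ→ℚ (m ℕ.* n) ≡ ℕ→ℚ m * ℕ→ℚ n
  ℕ→ℚ-* zero    n = sym (*-zeroˡ (ℕ→ℚ n))
  ℕ→ℚ-* (suc m) n = begin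
      ℕ→ℚ (n ℕ.+ m ℕ.* n)        ≡⟨ ℕ→ℚ-+ n (m ℕ.* n) ⟩
      ℕ→ℚ n + ℕ→ℚ (m ℕ.* n)      ≡⟨ cong (λ z → ℕ→ℚ n + z) (ℕ→ℚ-* m n) ⟩
      ℕ→ℚ n + ℕ→ℚ m * ℕ→ℚ n      ≡⟨ factor (ℕ→ℚ m) (ℕ→ℚ n) ⟩
      (ℕ→ℚ m + 1) * ℕ→ℚ n        ≡⟨ cong (_* ℕ→ℚ n) (ℕ→ℚ-suc m) ⟨
      ℕ→ℚ (suc m) * ℕ→ℚ n        ∎
    where
    factor : ∀ x y → y + x * y ≡ (x + 1) * y
    factor = solve-∀ ℚ-ring

  ℕ→ℚ-injective : ∀ {m n} → ℕ→ℚ m ≡ ℕ→ℚ n → m ≡ n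
  ℕ→ℚ-injective {m} {n} eq =
    ℤₚ.+-injective (cong ↥_ (trans (sym (ℕ→ℚ≡mkℚ m)) (trans eq (ℕ→ℚ≡mkℚ n))))

  ℕ→ℚ-suc≢0 : ∀ n → ℕ→ℚ (suc n) ≢ 0ℚ
  ℕ→ℚ-suc≢0 n eq with ℕ→ℚ-injective {suc n} {0} eq
  ... | ()

  ℕ→ℚ-+suc≢0 : ∀ m n → ℕ→ℚ m + ℕ→ℚ (suc n) ≢ 0ℚ
  ℕ→ℚ-+suc≢0 m n eq =
    ℕ→ℚ-suc≢0 (m ℕ.+ n) (trans (cong ℕ→ℚ (sym (ℕ.+-suc m n))) (trans (ℕ→ℚ-+ m (suc n)) eq))

  ℕ→ℚ-affine : ∀ a b n → ℕ→ℚ (a ℕ.+ b ℕ.* n) ≡ ℕ→ℚ b * ℕ→ℚ n + ℕ→ℚ a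
  ℕ→ℚ-affine a b n =
    trans (ℕ→ℚ-+ a (b ℕ.* n))
          (trans (cong (λ z → ℕ→ℚ a + z) (ℕ→ℚ-* b n)) (+-comm (ℕ→ℚ a) (ℕ→ℚ b * ℕ→ℚ n)))

  ℕ→ℚ-affine≢0 : ∀ a b n → ℕ→ℚ b * ℕ→ℚ n + ℕ→ℚ (suc a) ≢ 0ℚ
  ℕ→ℚ-affine≢0 a b n eq = ℕ→ℚ-suc≢0 (a ℕ.+ b ℕ.* n) (trans (ℕ→ℚ-affine (suc a) b n) eq)

  ℕ→ℚ-sub≢0 : ∀ a b n → ¬ (b ∣ a) → ℕ→ℚ a - ℕ→ℚ b * ℕ→ℚ n ≢ 0ℚ
  ℕ→ℚ-sub≢0 a b n b∤a eq = b∤a (divides n (trans a≡b*n (ℕ.*-comm b n)))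
    where
    a≡b*n : a ≡ b ℕ.* n
    a≡b*n = ℕ→ℚ-injective (trans (difference≡0⇒≡ eq) (sym (ℕ→ℚ-* b n)))

  two≢0 : 2 ≢ 0ℚ
  two≢0 = ℕ→ℚ-suc≢0 1

  ^-≢0 : ∀ {x} n → x ≢ 0ℚ → x ^ℚ n ≢ 0ℚ
  ^-≢0 zero    x≢0 = ℕ→ℚ-suc≢0 0
  ^-≢0 (suc n) x≢0 = *-≢0 x≢0 (^-≢0 n x≢0)

  Σ-cong : ∀ N {f g : ℕ → ℚ} → (∀ k → f k ≡ g k) → Σ[0≤k≤ N ] f ≡ Σ[0≤k≤ N ] g
  Σ-cong zero    f≡g = f≡g 0
  Σ-cong (suc N) f≡g = cong₂ _+_ (Σ-cong N f≡g) (f≡g (suc N))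

  Σ-linear : ∀ N α β (f g : ℕ → ℚ) →
             Σ[0≤k≤ N ] (λ k → α * f k + β * g k) ≡ α * Σ[0≤k≤ N ] f + β * Σ[0≤k≤ N ] g
  Σ-linear zero    α β f g = refl
  Σ-linear (suc N) α β f g =
    trans (cong (_+ (α * f (suc N) + β * g (suc N))) (Σ-linear N α β f g))
          (regroup α β (Σ[0≤k≤ N ] f) (Σ[0≤k≤ N ] g) (f (suc N)) (g (suc N)))
    where
    regroup : ∀ α β a b c d → α * a + β * b + (α * c + β * d) ≡ α * (a + c) + β * (b + d)
    regroup = solve-∀ ℚ-ring

  Σ-- : ∀ N (f g : ℕ → ℚ) → Σ[0≤k≤ N ] (λ k → f k - g k) ≡ Σ[0≤k≤ N ] f - Σ[0≤k≤ N ] g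
  Σ-- zero    f g = refl
  Σ-- (suc N) f g =
    trans (cong (_+ (f (suc N) - g (suc N))) (Σ-- N f g))
          (regroup (Σ[0≤k≤ N ] f) (Σ[0≤k≤ N ] g) (f (suc N)) (g (suc N)))
    where
    regroup : ∀ a b c d → a - b + (c - d) ≡ (a + c) - (b + d)
    regroup = solve-∀ ℚ-ring

  Σ-telescope : ∀ N (G : ℕ → ℚ) → Σ[0≤k≤ N ] (λ k → G (suc k) - G k) ≡ G (suc N) - G 0
  Σ-telescope zero    G = refl
  Σ-telescope (suc N) G =
    trans (cong (_+ (G (suc (suc N)) - G (suc N))) (Σ-telescope N G))
          (collapse (G 0) (G (suc N)) (G (suc (suc N))))
    where
    collapse : ∀ a b c → b - a + (c - b) ≡ c - a
    collapse = solve-∀ ℚ-ring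

  Σ-shift : ∀ N (f : ℕ → ℚ) → Σ[0≤k≤ suc N ] f ≡ f 0 + Σ[0≤k≤ N ] (λ k → f (suc k))
  Σ-shift zero    f = refl
  Σ-shift (suc N) f =
    trans (cong (_+ f (suc (suc N))) (Σ-shift N f))
          (+-assoc (f 0) (Σ[0≤k≤ N ] (λ k → f (suc k))) (f (suc (suc N))))

  -- The certificates of Gosper's and Zeilberger's algorithms used below all have the form G, for
  -- τ hypergeometric with τ (k + 1) / τ k = v k / U (k + 1); h carries the harmonic numbers.
  module Telescope (τ h : ℕ → ℚ) (U R : ℚ → ℚ) (v : ℕ → ℚ)
                   (ratio : ∀ k → U (ℕ→ℚ k + 1) * τ (suc k) ≡ v k * τ k) where

    G : ℕ → ℚ
    G k = U (ℕ→ℚ k) * R (ℕ→ℚ k) * τ k * h k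

    G-step : ∀ k → G (suc k) - G k ≡
               (v k * R (ℕ→ℚ k + 1) - U (ℕ→ℚ k) * R (ℕ→ℚ k)) * τ k * h k
               + v k * R (ℕ→ℚ k + 1) * τ k * (h (suc k) - h k)
    G-step k = begin
        G (suc k) - G k
      ≡⟨ cong (λ z → U z * R z * τ (suc k) * h (suc k) - G k) (ℕ→ℚ-suc k) ⟩
        U (y + 1) * R (y + 1) * τ (suc k) * h (suc k) - G k
      ≡⟨ regroup (U (y + 1)) (R (y + 1)) (τ (suc k)) (h (suc k)) (G k) ⟩
        U (y + 1) * τ (suc k) * (R (y + 1) * h (suc k)) - G k
      ≡⟨ cong (λ z → z * (R (y + 1) * h (suc k)) - G k) (ratio k) ⟩
        v k * τ k * (R (y + 1) * h (suc k)) - U y * R y * τ k * h k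
      ≡⟨ expand (v k) (τ k) (R (y + 1)) (h (suc k)) (U y) (R y) (h k) ⟩
        (v k * R (y + 1) - U y * R y) * τ k * h k + v k * R (y + 1) * τ k * (h (suc k) - h k)
      ∎
      where
      y = ℕ→ℚ k
      regroup : ∀ u r t h g → u * r * t * h - g ≡ u * t * (r * h) - g
      regroup = solve-∀ ℚ-ring
      expand : ∀ v t r₁ h₁ u r h → v * t * (r₁ * h₁) - u * r * t * h ≡ (v * r₁ - u * r) * t * h + v * r₁ * t * (h₁ - h)
      expand = solve-∀ ℚ-ring

    Σ-G-step≡0 : U 0ℚ ≡ 0ℚ → ∀ N → τ (suc N) ≡ 0ℚ → Σ[0≤k≤ N ] (λ k → G (suc k) - G k) ≡ 0ℚ
    Σ-G-step≡0 U0≡0 N τ≡0 = trans (Σ-telescope N G) (cong₂ _-_ G-last G-first)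
      where
      G-last : G (suc N) ≡ 0ℚ
      G-last = trans (cong (λ z → U (ℕ→ℚ (suc N)) * R (ℕ→ℚ (suc N)) * z * h (suc N)) τ≡0)
                     (annihilate (U (ℕ→ℚ (suc N))) (R (ℕ→ℚ (suc N))) (h (suc N)))
        where
        annihilate : ∀ u r h → u * r * 0ℚ * h ≡ 0ℚ
        annihilate = solve-∀ ℚ-ring
      G-first : G 0 ≡ 0ℚ
      G-first = trans (cong (λ z → z * R 0ℚ * τ 0 * h 0) U0≡0) (annihilate (R 0ℚ) (τ 0) (h 0))
        where
        annihilate : ∀ r t h → 0ℚ * r * t * h ≡ 0ℚ
        annihilate = solve-∀ ℚ-ring

  ℕ→ℚ-*+*≡* : ∀ a b c d e f → a ℕ.* b ℕ.+ c ℕ.* d ≡ e ℕ.* f →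
              ℕ→ℚ a * ℕ→ℚ b + ℕ→ℚ c * ℕ→ℚ d ≡ ℕ→ℚ e * ℕ→ℚ f
  ℕ→ℚ-*+*≡* a b c d e f eq = begin
      ℕ→ℚ a * ℕ→ℚ b + ℕ→ℚ c * ℕ→ℚ d  ≡⟨ cong₂ _+_ (ℕ→ℚ-* a b) (ℕ→ℚ-* c d) ⟨
      ℕ→ℚ (a ℕ.* b) + ℕ→ℚ (c ℕ.* d)  ≡⟨ ℕ→ℚ-+ (a ℕ.* b) (c ℕ.* d) ⟨
      ℕ→ℚ (a ℕ.* b ℕ.+ c ℕ.* d)      ≡⟨ cong ℕ→ℚ eq ⟩
      ℕ→ℚ (e ℕ.* f)                  ≡⟨ ℕ→ℚ-* e f ⟩
      ℕ→ℚ e * ℕ→ℚ f                  ∎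

  ℕ→ℚ-*≡* : ∀ a b c d → a ℕ.* b ≡ c ℕ.* d → ℕ→ℚ a * ℕ→ℚ b ≡ ℕ→ℚ c * ℕ→ℚ d
  ℕ→ℚ-*≡* a b c d eq = trans (sym (ℕ→ℚ-* a b)) (trans (cong ℕ→ℚ eq) (ℕ→ℚ-* c d))

  binomial-lower : ∀ n k → (ℕ→ℚ k + 1) * ℕ→ℚ (n C suc k) ≡ (ℕ→ℚ n - ℕ→ℚ k) * ℕ→ℚ (n C k)
  binomial-lower n k = begin
      (ℕ→ℚ k + 1) * ℕ→ℚ (n C suc k)  ≡⟨ cong (_* ℕ→ℚ (n C suc k)) (ℕ→ℚ-suc k) ⟨
      ℕ→ℚ (suc k) * ℕ→ℚ (n C suc k)  ≡⟨ ≡-sub (ℕ→ℚ-*+*≡* (suc k) (n C suc k) k (n C k) n (n C k)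
                                                            (C-lower-shift n k)) ⟩
      ℕ→ℚ n * B - ℕ→ℚ k * B          ≡⟨ factor (ℕ→ℚ n) (ℕ→ℚ k) B ⟩
      (ℕ→ℚ n - ℕ→ℚ k) * B            ∎
    where
    B = ℕ→ℚ (n C k)
    factor : ∀ x y b → x * b - y * b ≡ (x - y) * b
    factor = solve-∀ ℚ-ring

  binomial-upper : ∀ n k → (ℕ→ℚ n + 1) * ℕ→ℚ (n C k) ≡ (ℕ→ℚ n + 1 - ℕ→ℚ k) * ℕ→ℚ (suc n C k)
  binomial-upper n k = begin
      (ℕ→ℚ n + 1) * ℕ→ℚ (n C k)       ≡⟨ cong (_* ℕ→ℚ (n C k)) (ℕ→ℚ-suc n) ⟨
      ℕ→ℚ (suc n) * ℕ→ℚ (n C k)       ≡⟨ ≡-sub (ℕ→ℚ-*+*≡* (suc n) (n C k) k (suc n C k) (suc n) (suc n C k)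
                                                             (C-upper-shift n k)) ⟩
      ℕ→ℚ (suc n) * B - ℕ→ℚ k * B     ≡⟨ cong (λ z → z * B - ℕ→ℚ k * B) (ℕ→ℚ-suc n) ⟩
      (ℕ→ℚ n + 1) * B - ℕ→ℚ k * B     ≡⟨ factor (ℕ→ℚ n + 1) (ℕ→ℚ k) B ⟩
      (ℕ→ℚ n + 1 - ℕ→ℚ k) * B         ∎
    where
    B = ℕ→ℚ (suc n C k)
    factor : ∀ x y b → x * b - y * b ≡ (x - y) * b
    factor = solve-∀ ℚ-ring

  binomial-beyond : ∀ n → ℕ→ℚ (n C suc n) ≡ 0ℚ
  binomial-beyond n = cong ℕ→ℚ (k>n⇒nCk≡0 (ℕ.n<1+n n))

  c d : ℕ → ℚ
  c k = ℕ→ℚ ((1 ℕ.+ 2 ℕ.* k) C k)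
  d k = ℕ→ℚ ((2 ℕ.* k) C k)

  d-double : ∀ k → d (suc k) ≡ 2 * c k
  d-double k = trans (cong ℕ→ℚ (central-double k)) (ℕ→ℚ-* 2 (suc (2 ℕ.* k) C k))

  c-vs-d : ∀ k → (ℕ→ℚ k + 1) * c k ≡ (2 * ℕ→ℚ k + 1) * d k
  c-vs-d k = begin
      (ℕ→ℚ k + 1) * c k              ≡⟨ cong (_* c k) (ℕ→ℚ-suc k) ⟨
      ℕ→ℚ (suc k) * c k              ≡⟨ ℕ→ℚ-*≡* (suc k) _ (suc (2 ℕ.* k)) _ (central-absorption k) ⟩
      ℕ→ℚ (1 ℕ.+ 2 ℕ.* k) * d k      ≡⟨ cong (_* d k) (ℕ→ℚ-affine 1 2 k) ⟩
      (2 * ℕ→ℚ k + 1) * d k          ∎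

  c-vs-d-suc : ∀ k → (ℕ→ℚ k + 1 + 1) * c (suc k) ≡ (2 * ℕ→ℚ k + 3) * d (suc k)
  c-vs-d-suc k = begin
      (y + 1 + 1) * c (suc k)                ≡⟨ cong (λ z → (z + 1) * c (suc k)) (ℕ→ℚ-suc k) ⟨
      (ℕ→ℚ (suc k) + 1) * c (suc k)          ≡⟨ c-vs-d (suc k) ⟩
      (2 * ℕ→ℚ (suc k) + 1) * d (suc k)      ≡⟨ cong (λ z → (2 * z + 1) * d (suc k)) (ℕ→ℚ-suc k) ⟩
      (2 * (y + 1) + 1) * d (suc k)          ≡⟨ cong (_* d (suc k)) (simplify y) ⟩
      (2 * y + 3) * d (suc k)                ∎
    where
    y = ℕ→ℚ k
    simplify : ∀ y → 2 * (y + 1) + 1 ≡ 2 * y + 3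
    simplify = solve-∀ ℚ-ring

  c-ratio : ∀ k → (ℕ→ℚ k + 2) * c (suc k) ≡ (4 * ℕ→ℚ k + 6) * c k
  c-ratio k = begin
      (y + 2) * c (suc k)          ≡⟨ cong (_* c (suc k)) (two y) ⟩
      (y + 1 + 1) * c (suc k)      ≡⟨ c-vs-d-suc k ⟩
      (2 * y + 3) * d (suc k)      ≡⟨ cong ((2 * y + 3) *_) (d-double k) ⟩
      (2 * y + 3) * (2 * c k)      ≡⟨ regroup y (c k) ⟩
      (4 * y + 6) * c k            ∎
    where
    y = ℕ→ℚ k
    two : ∀ y → y + 2 ≡ y + 1 + 1
    two = solve-∀ ℚ-ring
    regroup : ∀ y c → (2 * y + 3) * (2 * c) ≡ (4 * y + 6) * c
    regroup = solve-∀ ℚ-ring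

  d-ratio : ∀ k → (ℕ→ℚ k + 1) * d (suc k) ≡ (4 * ℕ→ℚ k + 2) * d k
  d-ratio k = begin
      (y + 1) * d (suc k)          ≡⟨ cong ((y + 1) *_) (d-double k) ⟩
      (y + 1) * (2 * c k)          ≡⟨ regroup y (c k) ⟩
      2 * ((y + 1) * c k)          ≡⟨ cong (2 *_) (c-vs-d k) ⟩
      2 * ((2 * y + 1) * d k)      ≡⟨ regroup′ y (d k) ⟩
      (4 * y + 2) * d k            ∎
    where
    y = ℕ→ℚ k
    regroup : ∀ y c → (y + 1) * (2 * c) ≡ 2 * ((y + 1) * c)
    regroup = solve-∀ ℚ-ring
    regroup′ : ∀ y d → 2 * ((2 * y + 1) * d) ≡ (4 * y + 2) * d
    regroup′ = solve-∀ ℚ-ring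

  q : ℚ
  q = -[1+ 0 ] / 4

  t : ℕ → ℕ → ℚ
  t m j = ℕ→ℚ (m C j) * q ^ℚ j * d j

  u : ℕ → ℕ → ℚ
  u n k = q ^ℚ k * ℕ→ℚ (n C k) * c k

  t-ratio : ∀ m j → (ℕ→ℚ j + 1) * (ℕ→ℚ j + 1) * t m (suc j)
                    ≡ q * (ℕ→ℚ m - ℕ→ℚ j) * (4 * ℕ→ℚ j + 2) * t m j
  t-ratio m j = begin
      (y + 1) * (y + 1) * (ℕ→ℚ (m C suc j) * (q * p) * d (suc j))
    ≡⟨ regroup (y + 1) (ℕ→ℚ (m C suc j)) p (d (suc j)) ⟩
      (y + 1) * ℕ→ℚ (m C suc j) * (q * p) * ((y + 1) * d (suc j))
    ≡⟨ cong₂ (λ a b → a * (q * p) * b) (binomial-lower m j) (d-ratio j) ⟩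
      (ℕ→ℚ m - y) * ℕ→ℚ (m C j) * (q * p) * ((4 * y + 2) * d j)
    ≡⟨ regroup′ (ℕ→ℚ m - y) (4 * y + 2) (ℕ→ℚ (m C j)) p (d j) ⟩
      q * (ℕ→ℚ m - y) * (4 * y + 2) * t m j
    ∎
    where
    y = ℕ→ℚ j
    p = q ^ℚ j
    regroup : ∀ z b p e → z * z * (b * (q * p) * e) ≡ z * b * (q * p) * (z * e)
    regroup = solve-∀ ℚ-ring
    regroup′ : ∀ a e b p f → a * b * (q * p) * (e * f) ≡ q * a * e * (b * p * f)
    regroup′ = solve-∀ ℚ-ring

  t-upper : ∀ m j → (ℕ→ℚ m + 1) * t m j ≡ (ℕ→ℚ m + 1 - ℕ→ℚ j) * t (suc m) j
  t-upper m j = begin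
      (x + 1) * (ℕ→ℚ (m C j) * p * d j)            ≡⟨ reassoc (x + 1) (ℕ→ℚ (m C j)) p (d j) ⟩
      (x + 1) * ℕ→ℚ (m C j) * p * d j              ≡⟨ cong (λ z → z * p * d j) (binomial-upper m j) ⟩
      (x + 1 - y) * ℕ→ℚ (suc m C j) * p * d j      ≡⟨ reassoc (x + 1 - y) (ℕ→ℚ (suc m C j)) p (d j) ⟨
      (x + 1 - y) * t (suc m) j                    ∎
    where
    x = ℕ→ℚ m
    y = ℕ→ℚ j
    p = q ^ℚ j
    reassoc : ∀ a b c e → a * (b * c * e) ≡ a * b * c * e
    reassoc = solve-∀ ℚ-ring

  t-beyond : ∀ m → t m (suc m) ≡ 0ℚ
  t-beyond m = trans (cong (λ z → z * q ^ℚ suc m * d (suc m)) (binomial-beyond m)) (annihilate (q ^ℚ suc m) (d (suc m)))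
    where
    annihilate : ∀ a b → 0ℚ * a * b ≡ 0ℚ
    annihilate = solve-∀ ℚ-ring

  u-ratio : ∀ m k → (ℕ→ℚ k + 1) * (ℕ→ℚ k + 1 + 1) * u m (suc k)
                    ≡ q * (ℕ→ℚ m - ℕ→ℚ k) * (4 * ℕ→ℚ k + 6) * u m k
  u-ratio m k = begin
      (y + 1) * (y + 1 + 1) * (q * p * ℕ→ℚ (m C suc k) * c (suc k))
    ≡⟨ regroup y p (ℕ→ℚ (m C suc k)) (c (suc k)) ⟩
      q * p * ((y + 1) * ℕ→ℚ (m C suc k)) * ((y + 2) * c (suc k))
    ≡⟨ cong₂ (λ a b → q * p * a * b) (binomial-lower m k) (c-ratio k) ⟩
      q * p * ((ℕ→ℚ m - y) * ℕ→ℚ (m C k)) * ((4 * y + 6) * c k)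
    ≡⟨ regroup′ (ℕ→ℚ m - y) (4 * y + 6) p (ℕ→ℚ (m C k)) (c k) ⟩
      q * (ℕ→ℚ m - y) * (4 * y + 6) * u m k
    ∎
    where
    y = ℕ→ℚ k
    p = q ^ℚ k
    regroup : ∀ y p b e → (y + 1) * (y + 1 + 1) * (q * p * b * e) ≡ q * p * ((y + 1) * b) * ((y + 2) * e)
    regroup = solve-∀ ℚ-ring
    regroup′ : ∀ a e p b f → q * p * (a * b) * (e * f) ≡ q * a * e * (p * b * f)
    regroup′ = solve-∀ ℚ-ring

  u-upper : ∀ m k → (ℕ→ℚ m + 1) * u m k ≡ (ℕ→ℚ m + 1 - ℕ→ℚ k) * u (suc m) k
  u-upper m k = begin
      (x + 1) * (p * ℕ→ℚ (m C k) * c k)            ≡⟨ regroup (x + 1) p (ℕ→ℚ (m C k)) (c k) ⟩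
      p * ((x + 1) * ℕ→ℚ (m C k)) * c k            ≡⟨ cong (λ z → p * z * c k) (binomial-upper m k) ⟩
      p * ((x + 1 - y) * ℕ→ℚ (suc m C k)) * c k    ≡⟨ regroup (x + 1 - y) p (ℕ→ℚ (suc m C k)) (c k) ⟨
      (x + 1 - y) * u (suc m) k                    ∎
    where
    x = ℕ→ℚ m
    y = ℕ→ℚ k
    p = q ^ℚ k
    regroup : ∀ a p b e → a * (p * b * e) ≡ p * (a * b) * e
    regroup = solve-∀ ℚ-ring

  u-beyond : ∀ m → u m (suc m) ≡ 0ℚ
  u-beyond m = trans (cong (λ z → q ^ℚ suc m * z * c (suc m)) (binomial-beyond m)) (annihilate (q ^ℚ suc m) (c (suc m)))
    where
    annihilate : ∀ a b → a * 0ℚ * b ≡ 0ℚ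
    annihilate = solve-∀ ℚ-ring

  u-vs-t : ∀ m k → (ℕ→ℚ k + 1 + 1) * u m (suc k) ≡ (2 * ℕ→ℚ k + 3) * t m (suc k)
  u-vs-t m k = begin
      (y + 1 + 1) * (p * B * c (suc k))   ≡⟨ regroup (y + 1 + 1) p B (c (suc k)) ⟩
      B * p * ((y + 1 + 1) * c (suc k))   ≡⟨ cong (λ z → B * p * z) (c-vs-d-suc k) ⟩
      B * p * ((2 * y + 3) * d (suc k))   ≡⟨ regroup′ (2 * y + 3) B p (d (suc k)) ⟩
      (2 * y + 3) * t m (suc k)           ∎
    where
    y = ℕ→ℚ k
    p = q ^ℚ suc k
    B = ℕ→ℚ (m C suc k)
    regroup : ∀ a p b e → a * (p * b * e) ≡ b * p * (a * e)
    regroup = solve-∀ ℚ-ring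
    regroup′ : ∀ a b p e → b * p * (a * e) ≡ a * (b * p * e)
    regroup′ = solve-∀ ℚ-ring

  T : ℕ → ℚ
  T m = Σ[0≤k≤ m ] (t m)

  module T-Zeilberger (m : ℕ) where

    x : ℚ
    x = ℕ→ℚ m

    v : ℕ → ℚ
    v j = q * (x + 1 - ℕ→ℚ j) * (4 * ℕ→ℚ j + 2)

    ratio : ∀ j → (ℕ→ℚ j + 1) * (ℕ→ℚ j + 1) * t (suc m) (suc j) ≡ v j * t (suc m) j
    ratio j = trans (t-ratio (suc m) j) (cong (λ z → q * (z - ℕ→ℚ j) * (4 * ℕ→ℚ j + 2) * t (suc m) j) (ℕ→ℚ-suc m))

    open Telescope (t (suc m)) (λ _ → 1) (λ y → y * y) (λ _ → - 2) v ratio public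

    α β : ℚ
    α = 2 * (x + 1) * (x + 1)
    β = - ((x + 1) * (2 * x + 1))

    pointwise : ∀ j → α * t (suc m) j + β * t m j ≡ G (suc j) - G j
    pointwise j = begin
        α * τ + β * t m j
      ≡⟨ split x τ (t m j) ⟩
        2 * (x + 1) * (x + 1) * τ - (2 * x + 1) * ((x + 1) * t m j)
      ≡⟨ cong (λ z → 2 * (x + 1) * (x + 1) * τ - (2 * x + 1) * z) (t-upper m j) ⟩
        2 * (x + 1) * (x + 1) * τ - (2 * x + 1) * ((x + 1 - y) * τ)
      ≡⟨ certificate x y τ ⟩
        (v j * (- 2) - y * y * (- 2)) * τ * 1 + v j * (- 2) * τ * (1 - 1)
      ≡⟨ G-step j ⟨
        G (suc j) - G j
      ∎
      where
      y = ℕ→ℚ j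
      τ = t (suc m) j
      split : ∀ x a b → 2 * (x + 1) * (x + 1) * a + (- ((x + 1) * (2 * x + 1))) * b
                        ≡ 2 * (x + 1) * (x + 1) * a - (2 * x + 1) * ((x + 1) * b)
      split = solve-∀ ℚ-ring
      certificate : ∀ x y τ → 2 * (x + 1) * (x + 1) * τ - (2 * x + 1) * ((x + 1 - y) * τ)
                            ≡ (q * (x + 1 - y) * (4 * y + 2) * (- 2) - y * y * (- 2)) * τ * 1
                              + q * (x + 1 - y) * (4 * y + 2) * (- 2) * τ * (1 - 1)
      certificate = solve-∀ ℚ-ring

    combination≡0 : α * T (suc m) + β * T m ≡ 0ℚ
    combination≡0 = begin
        α * T (suc m) + β * T m                              ≡⟨ cong (λ z → α * T (suc m) + β * z) (+-identityʳ (T m)) ⟨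
        α * T (suc m) + β * (T m + 0ℚ)                       ≡⟨ cong (λ z → α * T (suc m) + β * (T m + z)) (t-beyond m) ⟨
        α * T (suc m) + β * Σ[0≤k≤ suc m ] (t m)             ≡⟨ Σ-linear (suc m) α β (t (suc m)) (t m) ⟨
        Σ[0≤k≤ suc m ] (λ j → α * t (suc m) j + β * t m j)   ≡⟨ Σ-cong (suc m) pointwise ⟩
        Σ[0≤k≤ suc m ] (λ j → G (suc j) - G j)               ≡⟨ Σ-G-step≡0 refl (suc m) (t-beyond (suc m)) ⟩
        0ℚ                                                   ∎

  T-recurrence : ∀ m → 2 * (ℕ→ℚ m + 1) * T (suc m) ≡ (2 * ℕ→ℚ m + 1) * T m
  T-recurrence m = *-cancelˡ (ℕ→ℚ-+suc≢0 m 0) (begin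
      (x + 1) * (2 * (x + 1) * T (suc m))                        ≡⟨ isolate x (T (suc m)) (T m) ⟩
      (α * T (suc m) + β * T m) + (x + 1) * ((2 * x + 1) * T m)  ≡⟨ cong (_+ (x + 1) * ((2 * x + 1) * T m)) combination≡0 ⟩
      0ℚ + (x + 1) * ((2 * x + 1) * T m)                         ≡⟨ +-identityˡ ((x + 1) * ((2 * x + 1) * T m)) ⟩
      (x + 1) * ((2 * x + 1) * T m)                              ∎)
    where
    open T-Zeilberger m
    isolate : ∀ x a b → (x + 1) * (2 * (x + 1) * a)
                      ≡ (2 * (x + 1) * (x + 1) * a + (- ((x + 1) * (2 * x + 1))) * b) + (x + 1) * ((2 * x + 1) * b)
    isolate = solve-∀ ℚ-ring

  T-closed : ∀ m → 4 ^ℚ m * T m ≡ d m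
  T-closed zero    = refl
  T-closed (suc m) = *-cancelˡ (*-≢0 two≢0 (ℕ→ℚ-+suc≢0 m 0)) (begin
      2 * (x + 1) * (4 * p * T (suc m))   ≡⟨ regroup (x + 1) p (T (suc m)) ⟩
      4 * p * (2 * (x + 1) * T (suc m))   ≡⟨ cong (4 * p *_) (T-recurrence m) ⟩
      4 * p * ((2 * x + 1) * T m)         ≡⟨ regroup′ x p (T m) ⟩
      2 * ((4 * x + 2) * (p * T m))       ≡⟨ cong (λ z → 2 * ((4 * x + 2) * z)) (T-closed m) ⟩
      2 * ((4 * x + 2) * d m)             ≡⟨ cong (2 *_) (d-ratio m) ⟨
      2 * ((x + 1) * d (suc m))           ≡⟨ *-assoc 2 (x + 1) (d (suc m)) ⟨
      2 * (x + 1) * d (suc m)             ∎)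
    where
    x = ℕ→ℚ m
    p = 4 ^ℚ m
    regroup : ∀ z p a → 2 * z * (4 * p * a) ≡ 4 * p * (2 * z * a)
    regroup = solve-∀ ℚ-ring
    regroup′ : ∀ x p a → 4 * p * ((2 * x + 1) * a) ≡ 2 * ((4 * x + 2) * (p * a))
    regroup′ = solve-∀ ℚ-ring

  w : ℚ → ℚ → ℚ
  w x y = (y - 1) * (4 * y + 1) * ((3 * x - 2) * y - 3 * x)

  W : ℕ → ℚ
  W m = Σ[0≤k≤ m ] (λ j → t m j * w (ℕ→ℚ m) (ℕ→ℚ j))

  δ γ : ℚ → ℚ
  δ x = (5 - 2 * x) * (3 - 2 * x) * (1 - 2 * x)
  γ x = x * (75 + x * (- 66 + x * (- 81 + 54 * x)))

  -- Found by Gosper's algorithm for the summand (δ w - γ) t.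
  W-certificate : ℚ → ℚ → ℚ
  W-certificate x y =
    (- 16 + x * (602 + x * (- 1146 + 468 * x)))
    + y * ((124 + x * (- 658 + x * (1024 - 408 * x))) + y * (- 48 + x * (200 + x * (- 256 + 96 * x))))

  W-closed : ∀ m → δ (ℕ→ℚ m) * W m ≡ γ (ℕ→ℚ m) * T m
  W-closed m = difference≡0⇒≡ (begin
      δ x * W m - γ x * T m                                       ≡⟨ -‿* (δ x * W m) (γ x) (T m) ⟩
      δ x * W m + (- γ x) * T m                                   ≡⟨ Σ-linear m (δ x) (- γ x) f (t m) ⟨
      Σ[0≤k≤ m ] (λ j → δ x * f j + (- γ x) * t m j)             ≡⟨ Σ-cong m pointwise ⟩
      Σ[0≤k≤ m ] (λ j → G (suc j) - G j)                          ≡⟨ Σ-G-step≡0 refl m (t-beyond m) ⟩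
      0ℚ                                                          ∎)
    where
    x = ℕ→ℚ m
    -‿* : ∀ a b c → a - b * c ≡ a + (- b) * c
    -‿* = solve-∀ ℚ-ring
    f : ℕ → ℚ
    f j = t m j * w x (ℕ→ℚ j)
    v : ℕ → ℚ
    v j = q * (x - ℕ→ℚ j) * (4 * ℕ→ℚ j + 2)
    open Telescope (t m) (λ _ → 1) (λ y → y * y) (W-certificate x) v (t-ratio m)
    certificate : ∀ x y τ →
      let δ z = (5 - 2 * z) * (3 - 2 * z) * (1 - 2 * z)
          γ z = z * (75 + z * (- 66 + z * (- 81 + 54 * z)))
          w z = (z - 1) * (4 * z + 1) * ((3 * x - 2) * z - 3 * x)
          R z = (- 16 + x * (602 + x * (- 1146 + 468 * x)))
                + z * ((124 + x * (- 658 + x * (1024 - 408 * x))) + z * (- 48 + x * (200 + x * (- 256 + 96 * x))))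
          v = q * (x - y) * (4 * y + 2)
      in δ x * (τ * w y) + (- γ x) * τ ≡ (v * R (y + 1) - y * y * R y) * τ * 1 + v * R (y + 1) * τ * (1 - 1)
    certificate = solve-∀ ℚ-ring
    pointwise : ∀ j → δ x * f j + (- γ x) * t m j ≡ G (suc j) - G j
    pointwise j = trans (certificate x (ℕ→ℚ j) (t m j)) (sym (G-step j))

  ℕ→ℚ-recip : ∀ n → ℕ→ℚ (suc n) * (+ 1 / suc n) ≡ 1
  ℕ→ℚ-recip n rewrite ℕ→ℚ≡mkℚ (suc n) | normalize-coprime {1} {n} (1-coprimeTo (suc n)) =
    *-inverseʳ (mkℚ (+ suc n) 0 (coprime-sym (1-coprimeTo (suc n))))

  H-increment : ∀ n → (ℕ→ℚ n + 1) * (H (suc n) - H n) ≡ 1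
  H-increment n = begin
      (ℕ→ℚ n + 1) * (H n + r - H n)   ≡⟨ cancel (ℕ→ℚ n + 1) (H n) r ⟩
      (ℕ→ℚ n + 1) * r                 ≡⟨ cong (_* r) (ℕ→ℚ-suc n) ⟨
      ℕ→ℚ (suc n) * r                 ≡⟨ ℕ→ℚ-recip n ⟩
      1                               ∎
    where
    r = + 1 / suc n
    cancel : ∀ z H r → z * (H + r - H) ≡ z * r
    cancel = solve-∀ ℚ-ring

  h : ℕ → ℚ
  h k = H (1 ℕ.+ 2 ℕ.* k)

  h-increment : ∀ k → (2 * ℕ→ℚ k + 2) * (2 * ℕ→ℚ k + 3) * (h (suc k) - h k) ≡ 4 * ℕ→ℚ k + 5
  h-increment k = begin
      (2 * y + 2) * (2 * y + 3) * (h (suc k) - h k)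
    ≡⟨ cong (λ z → (2 * y + 2) * (2 * y + 3) * (H z - h k)) (cong suc (ℕ.*-suc 2 k)) ⟩
      (2 * y + 2) * (2 * y + 3) * (h k + r₂ + r₃ - h k)
    ≡⟨ distribute (2 * y + 2) (2 * y + 3) (h k) r₂ r₃ ⟩
      (2 * y + 3) * ((2 * y + 2) * r₂) + (2 * y + 2) * ((2 * y + 3) * r₃)
    ≡⟨ cong₂ (λ e f → (2 * y + 3) * e + (2 * y + 2) * f) (recip 1) (recip 2) ⟩
      (2 * y + 3) * 1 + (2 * y + 2) * 1
    ≡⟨ collect y ⟩
      4 * y + 5
    ∎
    where
    y = ℕ→ℚ k
    r₂ = + 1 / suc (suc (2 ℕ.* k))
    r₃ = + 1 / suc (suc (suc (2 ℕ.* k)))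
    recip : ∀ a → (2 * y + ℕ→ℚ (suc a)) * (+ 1 / suc (a ℕ.+ 2 ℕ.* k)) ≡ 1
    recip a = trans (cong (_* (+ 1 / suc (a ℕ.+ 2 ℕ.* k))) (sym (ℕ→ℚ-affine (suc a) 2 k))) (ℕ→ℚ-recip (a ℕ.+ 2 ℕ.* k))
    distribute : ∀ e f h r s → e * f * (h + r + s - h) ≡ f * (e * r) + e * (f * s)
    distribute = solve-∀ ℚ-ring
    collect : ∀ y → (2 * y + 3) * 1 + (2 * y + 2) * 1 ≡ 4 * y + 5
    collect = solve-∀ ℚ-ring

  s : ℕ → ℚ
  s n = Σ[0≤k≤ n ] (λ k → u n k * (ℕ→ℚ k * ℕ→ℚ k) * h k)

  a b : ℚ → ℚ
  a x = 2 * x * (2 - 3 * x) * (x + 2)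
  b x = - ((x + 1) * (3 * x + 1) * (3 - 2 * x))

  module s-Zeilberger (n : ℕ) where

    x : ℚ
    x = ℕ→ℚ n

    F : ℕ → ℕ → ℚ
    F m k = u m k * (ℕ→ℚ k * ℕ→ℚ k) * h k

    F-beyond : ∀ m → F m (suc m) ≡ 0ℚ
    F-beyond m = trans (cong (λ z → z * (y * y) * h (suc m)) (u-beyond m)) (annihilate (y * y) (h (suc m)))
      where
      y = ℕ→ℚ (suc m)
      annihilate : ∀ a b → 0ℚ * a * b ≡ 0ℚ
      annihilate = solve-∀ ℚ-ring

    v : ℕ → ℚ
    v k = q * (x + 1 - ℕ→ℚ k) * (4 * ℕ→ℚ k + 6)

    -- Found by Zeilberger's algorithm.
    R : ℚ → ℚ
    R y = 2 * (y - 1) * ((3 * x + 1) * y - 3 * (x + 1))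

    ratio : ∀ k → (ℕ→ℚ k + 1) * (ℕ→ℚ k + 1 + 1) * u (suc n) (suc k) ≡ v k * u (suc n) k
    ratio k = trans (u-ratio (suc n) k)
                    (cong (λ z → q * (z - ℕ→ℚ k) * (4 * ℕ→ℚ k + 6) * u (suc n) k) (ℕ→ℚ-suc n))

    open Telescope (u (suc n)) h (λ y → y * (y + 1)) R v ratio public

    ℓ : ℕ → ℚ
    ℓ k = t (suc n) (suc k) * w (ℕ→ℚ (suc n)) (ℕ→ℚ (suc k))

    ℓ-identity : ∀ k → v k * R (ℕ→ℚ k + 1) * u (suc n) k * (h (suc k) - h k) ≡ ℓ k
    ℓ-identity k = begin
        v k * R (y + 1) * τ * Δh                       ≡⟨ regroup (v k) (R (y + 1)) τ Δh ⟩
        R (y + 1) * Δh * (v k * τ)                     ≡⟨ cong (λ z → R (y + 1) * Δh * z) (ratio k) ⟨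
        R (y + 1) * Δh * ((y + 1) * (y + 1 + 1) * τ′)  ≡⟨ regroup′ (R (y + 1)) Δh (y + 1) (y + 1 + 1) τ′ ⟩
        (y + 1) * R (y + 1) * Δh * ((y + 1 + 1) * τ′)  ≡⟨ cong (λ z → (y + 1) * R (y + 1) * Δh * z) (u-vs-t (suc n) k) ⟩
        (y + 1) * R (y + 1) * Δh * ((2 * y + 3) * t′)  ≡⟨ clear x y Δh t′ ⟩
        K * t′ * ((2 * y + 2) * (2 * y + 3) * Δh)      ≡⟨ cong (λ z → K * t′ * z) (h-increment k) ⟩
        K * t′ * (4 * y + 5)                           ≡⟨ weight x y t′ ⟩
        t′ * w (x + 1) (y + 1)                         ≡⟨ cong₂ (λ X Y → t′ * w X Y) (ℕ→ℚ-suc n) (ℕ→ℚ-suc k) ⟨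
        ℓ k                                            ∎
      where
      y = ℕ→ℚ k
      τ = u (suc n) k
      τ′ = u (suc n) (suc k)
      t′ = t (suc n) (suc k)
      Δh = h (suc k) - h k
      K = y * ((3 * x + 1) * (y + 1) - 3 * (x + 1))
      regroup : ∀ v r τ e → v * r * τ * e ≡ r * e * (v * τ)
      regroup = solve-∀ ℚ-ring
      regroup′ : ∀ r e z z′ τ → r * e * (z * z′ * τ) ≡ z * r * e * (z′ * τ)
      regroup′ = solve-∀ ℚ-ring
      clear : ∀ x y e t → (y + 1) * (2 * (y + 1 - 1) * ((3 * x + 1) * (y + 1) - 3 * (x + 1))) * e * ((2 * y + 3) * t)
                          ≡ y * ((3 * x + 1) * (y + 1) - 3 * (x + 1)) * t * ((2 * y + 2) * (2 * y + 3) * e)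
      clear = solve-∀ ℚ-ring
      weight : ∀ x y t → y * ((3 * x + 1) * (y + 1) - 3 * (x + 1)) * t * (4 * y + 5)
                         ≡ t * ((y + 1 - 1) * (4 * (y + 1) + 1) * ((3 * (x + 1) - 2) * (y + 1) - 3 * (x + 1)))
      weight = solve-∀ ℚ-ring

    pointwise : ∀ k → a x * F (suc n) k + b x * F n k ≡ (G (suc k) - G k) - ℓ k
    pointwise k = begin
        a x * (τ * (y * y) * h k) + b x * (u n k * (y * y) * h k)
      ≡⟨ split x y τ (h k) (u n k) ⟩
        a x * (τ * (y * y) * h k) - (3 * x + 1) * (3 - 2 * x) * ((x + 1) * u n k) * (y * y) * h k
      ≡⟨ cong (λ z → a x * (τ * (y * y) * h k) - (3 * x + 1) * (3 - 2 * x) * z * (y * y) * h k) (u-upper n k) ⟩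
        a x * (τ * (y * y) * h k) - (3 * x + 1) * (3 - 2 * x) * ((x + 1 - y) * τ) * (y * y) * h k
      ≡⟨ certificate x y τ (h k) (h (suc k)) ⟩
        ((v k * R (y + 1) - y * (y + 1) * R y) * τ * h k + v k * R (y + 1) * τ * (h (suc k) - h k))
        - v k * R (y + 1) * τ * (h (suc k) - h k)
      ≡⟨ cong₂ _-_ (G-step k) (sym (ℓ-identity k)) ⟨
        (G (suc k) - G k) - ℓ k
      ∎
      where
      y = ℕ→ℚ k
      τ = u (suc n) k
      split : ∀ x y τ h u → 2 * x * (2 - 3 * x) * (x + 2) * (τ * (y * y) * h)
                            + (- ((x + 1) * (3 * x + 1) * (3 - 2 * x))) * (u * (y * y) * h)
                          ≡ 2 * x * (2 - 3 * x) * (x + 2) * (τ * (y * y) * h) - (3 * x + 1) * (3 - 2 * x) * ((x + 1) * u) * (y * y) * h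
      split = solve-∀ ℚ-ring
      certificate : ∀ x y τ h₀ h₁ →
        let R z = 2 * (z - 1) * ((3 * x + 1) * z - 3 * (x + 1))
            v = q * (x + 1 - y) * (4 * y + 6)
        in 2 * x * (2 - 3 * x) * (x + 2) * (τ * (y * y) * h₀) - (3 * x + 1) * (3 - 2 * x) * ((x + 1 - y) * τ) * (y * y) * h₀
           ≡ ((v * R (y + 1) - y * (y + 1) * R y) * τ * h₀ + v * R (y + 1) * τ * (h₁ - h₀)) - v * R (y + 1) * τ * (h₁ - h₀)
      certificate = solve-∀ ℚ-ring

    ℓ-sum : Σ[0≤k≤ suc n ] ℓ ≡ W (suc n) - 3 * (x + 1)
    ℓ-sum = begin
        Σ[0≤k≤ suc n ] ℓ
      ≡⟨ ≡-sub (trans (+-comm (Σ[0≤k≤ suc n ] ℓ) (f 0)) (sym (Σ-shift (suc n) f))) ⟩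
        Σ[0≤k≤ suc (suc n) ] f - f 0
      ≡⟨ cong₂ _-_ (trans (cong (λ z → W (suc n) + z) f-last) (+-identityʳ (W (suc n)))) f-first ⟩
        W (suc n) - 3 * (x + 1)
      ∎
      where
      f : ℕ → ℚ
      f j = t (suc n) j * w (ℕ→ℚ (suc n)) (ℕ→ℚ j)
      f-last : f (suc (suc n)) ≡ 0ℚ
      f-last = trans (cong (_* w (ℕ→ℚ (suc n)) (ℕ→ℚ (suc (suc n)))) (t-beyond (suc n)))
                     (*-zeroˡ (w (ℕ→ℚ (suc n)) (ℕ→ℚ (suc (suc n)))))
      f-first : f 0 ≡ 3 * (x + 1)
      f-first = trans (at-zero (ℕ→ℚ (suc n))) (cong (3 *_) (ℕ→ℚ-suc n))
        where
        at-zero : ∀ X → 1 * ((0 - 1) * (4 * 0 + 1) * ((3 * X - 2) * 0 - 3 * X)) ≡ 3 * X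
        at-zero = solve-∀ ℚ-ring

  s-recurrence : ∀ n → a (ℕ→ℚ n) * s (suc n) + b (ℕ→ℚ n) * s n ≡ 3 * (ℕ→ℚ n + 1) - W (suc n)
  s-recurrence n = begin
      a x * s (suc n) + b x * s n                         ≡⟨ cong (λ z → a x * s (suc n) + b x * z) s-extend ⟩
      a x * s (suc n) + b x * Σ[0≤k≤ suc n ] (F n)        ≡⟨ Σ-linear (suc n) (a x) (b x) (F (suc n)) (F n) ⟨
      Σ[0≤k≤ suc n ] (λ k → a x * F (suc n) k + b x * F n k)  ≡⟨ Σ-cong (suc n) pointwise ⟩
      Σ[0≤k≤ suc n ] (λ k → (G (suc k) - G k) - ℓ k)     ≡⟨ Σ-- (suc n) (λ k → G (suc k) - G k) ℓ ⟩
      Σ[0≤k≤ suc n ] (λ k → G (suc k) - G k) - Σ[0≤k≤ suc n ] ℓ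
                                                          ≡⟨ cong₂ _-_ (Σ-G-step≡0 refl (suc n) (u-beyond (suc n))) ℓ-sum ⟩
      0ℚ - (W (suc n) - 3 * (x + 1))                      ≡⟨ flip (W (suc n)) (3 * (x + 1)) ⟩
      3 * (x + 1) - W (suc n)                             ∎
    where
    open s-Zeilberger n
    flip : ∀ a b → 0ℚ - (a - b) ≡ b - a
    flip = solve-∀ ℚ-ring
    s-extend : s n ≡ Σ[0≤k≤ suc n ] (F n)
    s-extend = sym (trans (cong (λ z → s n + z) (F-beyond n)) (+-identityʳ (s n)))

  A P Q E ρ σ : ℚ → ℚ
  A x = 3 * x * (2 - 3 * x)
  P x = (3 - 2 * x) * (1 - 4 * (x * x))
  Q x = 1 - 4 * (x * x)
  E x = 3 * x * (3 - 2 * x) * (2 - 3 * x)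
  ρ x = 3 - 8 * x - 12 * (x * x)
  σ x = 9 + x * (3 - 25 * x + 6 * (x * x))

  g : ℕ → ℚ
  g n = A (ℕ→ℚ n) * inv (P (ℕ→ℚ n) * 4 ^ℚ n) * c n

  V : ℕ → ℚ
  V n = 2 * h n - (+ 3 / 2) * H n - ρ (ℕ→ℚ n) * inv (Q (ℕ→ℚ n)) + σ (ℕ→ℚ n) * inv (E (ℕ→ℚ n))

  closed : ℕ → ℚ
  closed n = g n * V n - inv (1 + ℕ→ℚ n)

  Q≢0 : ∀ n → Q (ℕ→ℚ n) ≢ 0ℚ
  Q≢0 n Q≡0 = *-≢0 (ℕ→ℚ-sub≢0 1 2 n (from-no (2 ∣? 1))) (ℕ→ℚ-affine≢0 0 2 n) (trans (sym (factor (ℕ→ℚ n))) Q≡0)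
    where
    factor : ∀ x → 1 - 4 * (x * x) ≡ (1 - 2 * x) * (2 * x + 1)
    factor = solve-∀ ℚ-ring

  P≢0 : ∀ n → P (ℕ→ℚ n) ≢ 0ℚ
  P≢0 n = *-≢0 (ℕ→ℚ-sub≢0 3 2 n (from-no (2 ∣? 3))) (Q≢0 n)

  E≢0 : ∀ n → E (ℕ→ℚ (suc n)) ≢ 0ℚ
  E≢0 n = *-≢0 (*-≢0 (*-≢0 (ℕ→ℚ-suc≢0 2) (ℕ→ℚ-suc≢0 n)) (ℕ→ℚ-sub≢0 3 2 (suc n) (from-no (2 ∣? 3))))
                (ℕ→ℚ-sub≢0 2 3 (suc n) (from-no (3 ∣? 2)))

  δ≢0 : ∀ n → δ (ℕ→ℚ n) ≢ 0ℚ
  δ≢0 n = *-≢0 (*-≢0 (ℕ→ℚ-sub≢0 5 2 n (from-no (2 ∣? 5))) (ℕ→ℚ-sub≢0 3 2 n (from-no (2 ∣? 3))))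
               (ℕ→ℚ-sub≢0 1 2 n (from-no (2 ∣? 1)))

  a≢0 : ∀ n → a (ℕ→ℚ (suc n)) ≢ 0ℚ
  a≢0 n = *-≢0 (*-≢0 (*-≢0 two≢0 (ℕ→ℚ-suc≢0 n)) (ℕ→ℚ-sub≢0 2 3 (suc n) (from-no (3 ∣? 2))))
               (ℕ→ℚ-+suc≢0 (suc n) 1)

  g-cleared : ∀ n → P (ℕ→ℚ n) * 4 ^ℚ n * g n ≡ A (ℕ→ℚ n) * c n
  g-cleared n = begin
      D * (A x * inv D * c n)        ≡⟨ regroup D (A x) (inv D) (c n) ⟩
      A x * c n * (D * inv D)        ≡⟨ cong (A x * c n *_) (inv-inverseʳ (*-≢0 (P≢0 n) (^-≢0 n (ℕ→ℚ-suc≢0 3)))) ⟩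
      A x * c n * 1ℚ                 ≡⟨ *-identityʳ (A x * c n) ⟩
      A x * c n                      ∎
    where
    x = ℕ→ℚ n
    D = P x * 4 ^ℚ n
    regroup : ∀ d a i c → d * (a * i * c) ≡ a * c * (d * i)
    regroup = solve-∀ ℚ-ring

  g-recurrence : ∀ n → a (ℕ→ℚ n) * g (suc n) ≡ - (b (ℕ→ℚ n) * g n)
  g-recurrence n = *-cancelˡ K≢0 (begin
      K * (a x * g (suc n))                          ≡⟨ regroup₁ (P X) (4 * p) (P x * p) (x + 2) (a x) (g (suc n)) ⟩
      a x * (P x * p) * (x + 2) * (P X * (4 * p) * g (suc n))
                                                     ≡⟨ cong (a x * (P x * p) * (x + 2) *_) (g-cleared (suc n)) ⟩
      a x * (P x * p) * (x + 2) * (A X * c (suc n))  ≡⟨ regroup₂ (a x * (P x * p)) (x + 2) (A X) (c (suc n)) ⟩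
      a x * (P x * p) * A X * ((x + 2) * c (suc n))  ≡⟨ cong (a x * (P x * p) * A X *_) (c-ratio n) ⟩
      a x * (P x * p) * A X * ((4 * x + 6) * c n)    ≡⟨ cong (λ z → a x * (P x * p) * A z * ((4 * x + 6) * c n)) (ℕ→ℚ-suc n) ⟩
      a x * (P x * p) * A (x + 1) * ((4 * x + 6) * c n)
                                                     ≡⟨ hypergeometric x p (c n) ⟩
      - b x * P (x + 1) * (4 * p) * (x + 2) * (A x * c n)
                                                     ≡⟨ cong (λ z → - b x * P z * (4 * p) * (x + 2) * (A x * c n)) (ℕ→ℚ-suc n) ⟨
      - b x * P X * (4 * p) * (x + 2) * (A x * c n)  ≡⟨ cong (- b x * P X * (4 * p) * (x + 2) *_) (g-cleared n) ⟨
      - b x * P X * (4 * p) * (x + 2) * (P x * p * g n)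
                                                     ≡⟨ regroup₃ (b x) (P X) (4 * p) (x + 2) (P x * p) (g n) ⟩
      K * - (b x * g n)                              ∎)
    where
    x = ℕ→ℚ n
    X = ℕ→ℚ (suc n)
    p = 4 ^ℚ n
    K = P X * (4 * p) * (P x * p) * (x + 2)
    K≢0 : K ≢ 0ℚ
    K≢0 = *-≢0 (*-≢0 (*-≢0 (P≢0 (suc n)) (^-≢0 (suc n) (ℕ→ℚ-suc≢0 3)))
                     (*-≢0 (P≢0 n) (^-≢0 n (ℕ→ℚ-suc≢0 3))))
               (ℕ→ℚ-+suc≢0 n 1)
    regroup₁ : ∀ P₁ p₁ P₀ z α γ → P₁ * p₁ * P₀ * z * (α * γ) ≡ α * P₀ * z * (P₁ * p₁ * γ)
    regroup₁ = solve-∀ ℚ-ring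
    regroup₂ : ∀ α z A γ → α * z * (A * γ) ≡ α * A * (z * γ)
    regroup₂ = solve-∀ ℚ-ring
    regroup₃ : ∀ β P₁ p₁ z P₀ γ → - β * P₁ * p₁ * z * (P₀ * γ) ≡ P₁ * p₁ * P₀ * z * - (β * γ)
    regroup₃ = solve-∀ ℚ-ring
    hypergeometric : ∀ x p c →
      let a y = 2 * y * (2 - 3 * y) * (y + 2)
          b y = - ((y + 1) * (3 * y + 1) * (3 - 2 * y))
          A y = 3 * y * (2 - 3 * y)
          P y = (3 - 2 * y) * (1 - 4 * (y * y))
      in a x * (P x * p) * A (x + 1) * ((4 * x + 6) * c) ≡ - b x * P (x + 1) * (4 * p) * (x + 2) * (A x * c)
    hypergeometric = solve-∀ ℚ-ring

  fractions-cleared : ∀ {e f} r s → e ≢ 0ℚ → f ≢ 0ℚ → e * f * (s * inv f - r * inv e) ≡ s * e - r * f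
  fractions-cleared {e} {f} r s e≢0 f≢0 = begin
      e * f * (s * inv f - r * inv e)          ≡⟨ distribute e f r s (inv e) (inv f) ⟩
      s * e * (f * inv f) - r * f * (e * inv e) ≡⟨ cong₂ (λ i j → s * e * i - r * f * j) (inv-inverseʳ f≢0) (inv-inverseʳ e≢0) ⟩
      s * e * 1ℚ - r * f * 1ℚ                  ≡⟨ cong₂ _-_ (*-identityʳ (s * e)) (*-identityʳ (r * f)) ⟩
      s * e - r * f                            ∎
    where
    distribute : ∀ e f r s i j → e * f * (s * j - r * i) ≡ s * e * (f * j) - r * f * (e * i)
    distribute = solve-∀ ℚ-ring

  rational-part : ℚ → ℚ
  rational-part x = σ x * inv (E x) - ρ x * inv (Q x)

  V-split : ∀ n → V n ≡ 2 * h n - (+ 3 / 2) * H n + rational-part (ℕ→ℚ n)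
  V-split n = regroup (h n) (H n) (ρ x) (inv (Q x)) (σ x) (inv (E x))
    where
    x = ℕ→ℚ n
    regroup : ∀ h H r i s j → 2 * h - (+ 3 / 2) * H - r * i + s * j ≡ 2 * h - (+ 3 / 2) * H + (s * j - r * i)
    regroup = solve-∀ ℚ-ring

  N : ℚ → ℚ
  N y = σ y * Q y - ρ y * E y

  ΔV-denominator ΔV-numerator : ℚ → ℚ → ℚ
  ΔV-denominator x X = (x + 1) * (2 * x + 3) * (Q x * E x) * (Q X * E X)
  ΔV-numerator x X = Q x * E x * (Q X * E X) * ((4 * x + 5) - (+ 3 / 2) * (2 * x + 3) * 1)
                     + (x + 1) * (2 * x + 3) * (Q x * E x * N X - Q X * E X * N x)

  ΔV-cleared : ∀ n → E (ℕ→ℚ n) ≢ 0ℚ →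
               ΔV-denominator (ℕ→ℚ n) (ℕ→ℚ (suc n)) * (V (suc n) - V n) ≡ ΔV-numerator (ℕ→ℚ n) (ℕ→ℚ (suc n))
  ΔV-cleared n E≢0′ = begin
      ΔV-denominator x X * (V (suc n) - V n)
    ≡⟨ cong₂ (λ u w → ΔV-denominator x X * (u - w)) (V-split (suc n)) (V-split n) ⟩
      ΔV-denominator x X * ((2 * h (suc n) - (+ 3 / 2) * H (suc n) + r₁) - (2 * h n - (+ 3 / 2) * H n + r₀))
    ≡⟨ separate x (Q x) (E x) (Q X) (E X) (h n) (h (suc n)) (H n) (H (suc n)) r₀ r₁ ⟩
      Q x * E x * (Q X * E X) * ((2 * x + 2) * (2 * x + 3) * (h (suc n) - h n) - (+ 3 / 2) * (2 * x + 3) * ((x + 1) * (H (suc n) - H n)))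
      + (x + 1) * (2 * x + 3) * (Q x * E x * (Q X * E X * r₁) - Q X * E X * (Q x * E x * r₀))
    ≡⟨ cong₂ (λ α β → Q x * E x * (Q X * E X) * (α - (+ 3 / 2) * (2 * x + 3) * β)
                      + (x + 1) * (2 * x + 3) * (Q x * E x * (Q X * E X * r₁) - Q X * E X * (Q x * E x * r₀)))
             (h-increment n) (H-increment n) ⟩
      Q x * E x * (Q X * E X) * ((4 * x + 5) - (+ 3 / 2) * (2 * x + 3) * 1)
      + (x + 1) * (2 * x + 3) * (Q x * E x * (Q X * E X * r₁) - Q X * E X * (Q x * E x * r₀))
    ≡⟨ cong₂ (λ α β → Q x * E x * (Q X * E X) * ((4 * x + 5) - (+ 3 / 2) * (2 * x + 3) * 1)
                      + (x + 1) * (2 * x + 3) * (Q x * E x * α - Q X * E X * β))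
             (fractions-cleared (ρ X) (σ X) (Q≢0 (suc n)) (E≢0 n)) (fractions-cleared (ρ x) (σ x) (Q≢0 n) E≢0′) ⟩
      ΔV-numerator x X
    ∎
    where
    x = ℕ→ℚ n
    X = ℕ→ℚ (suc n)
    r₀ = rational-part x
    r₁ = rational-part X
    separate : ∀ x q e q′ e′ h₀ h₁ H₀ H₁ r₀ r₁ →
      (x + 1) * (2 * x + 3) * (q * e) * (q′ * e′) * ((2 * h₁ - (+ 3 / 2) * H₁ + r₁) - (2 * h₀ - (+ 3 / 2) * H₀ + r₀))
      ≡ q * e * (q′ * e′) * ((2 * x + 2) * (2 * x + 3) * (h₁ - h₀) - (+ 3 / 2) * (2 * x + 3) * ((x + 1) * (H₁ - H₀)))
        + (x + 1) * (2 * x + 3) * (q * e * (q′ * e′ * r₁) - q′ * e′ * (q * e * r₀))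
    separate = solve-∀ ℚ-ring

  ΔV-identity : ∀ x → 2 * δ (x + 1) * b x * A x * ΔV-numerator x (x + 1) ≡ ΔV-denominator x (x + 1) * (γ (x + 1) * P x)
  ΔV-identity = expanded
    where
    expanded : ∀ x →
      let X = x + 1
          Q y = 1 - 4 * (y * y)
          E y = 3 * y * (3 - 2 * y) * (2 - 3 * y)
          ρ y = 3 - 8 * y - 12 * (y * y)
          σ y = 9 + y * (3 - 25 * y + 6 * (y * y))
          N y = σ y * Q y - ρ y * E y
          δ y = (5 - 2 * y) * (3 - 2 * y) * (1 - 2 * y)
          γ y = y * (75 + y * (- 66 + y * (- 81 + 54 * y)))
          b y = - ((y + 1) * (3 * y + 1) * (3 - 2 * y))
          A y = 3 * y * (2 - 3 * y)
          P y = (3 - 2 * y) * (1 - 4 * (y * y))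
      in 2 * δ X * b x * A x
           * (Q x * E x * (Q X * E X) * ((4 * x + 5) - (+ 3 / 2) * (2 * x + 3) * 1)
              + (x + 1) * (2 * x + 3) * (Q x * E x * N X - Q X * E X * N x))
         ≡ (x + 1) * (2 * x + 3) * (Q x * E x) * (Q X * E X) * (γ X * P x)
    expanded = solve-∀ ℚ-ring

  V-increment : ∀ n → E (ℕ→ℚ n) ≢ 0ℚ →
                2 * δ (ℕ→ℚ (suc n)) * b (ℕ→ℚ n) * A (ℕ→ℚ n) * (V (suc n) - V n) ≡ γ (ℕ→ℚ (suc n)) * P (ℕ→ℚ n)
  V-increment n E≢0′ = *-cancelˡ M≢0 (begin
      ΔV-denominator x X * (2 * δ X * b x * A x * (V (suc n) - V n))
    ≡⟨ regroup (ΔV-denominator x X) (2 * δ X * b x * A x) (V (suc n) - V n) ⟩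
      2 * δ X * b x * A x * (ΔV-denominator x X * (V (suc n) - V n))
    ≡⟨ cong (2 * δ X * b x * A x *_) (ΔV-cleared n E≢0′) ⟩
      2 * δ X * b x * A x * ΔV-numerator x X
    ≡⟨ cong (λ z → 2 * δ z * b x * A x * ΔV-numerator x z) (ℕ→ℚ-suc n) ⟩
      2 * δ (x + 1) * b x * A x * ΔV-numerator x (x + 1)
    ≡⟨ ΔV-identity x ⟩
      ΔV-denominator x (x + 1) * (γ (x + 1) * P x)
    ≡⟨ cong (λ z → ΔV-denominator x z * (γ z * P x)) (ℕ→ℚ-suc n) ⟨
      ΔV-denominator x X * (γ X * P x)
    ∎)
    where
    x = ℕ→ℚ n
    X = ℕ→ℚ (suc n)
    M≢0 : ΔV-denominator x X ≢ 0ℚ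
    M≢0 = *-≢0 (*-≢0 (*-≢0 (ℕ→ℚ-+suc≢0 n 0) (ℕ→ℚ-affine≢0 2 2 n)) (*-≢0 (Q≢0 n) E≢0′))
               (*-≢0 (Q≢0 (suc n)) (E≢0 n))
    regroup : ∀ m c v → m * (c * v) ≡ c * (m * v)
    regroup = solve-∀ ℚ-ring

  variation-of-constants : ∀ n → E (ℕ→ℚ n) ≢ 0ℚ → b (ℕ→ℚ n) * g n * (V (suc n) - V n) ≡ W (suc n)
  variation-of-constants n E≢0′ = *-cancelˡ K≢0 (begin
      K * (b x * g n * ΔV)                    ≡⟨ regroup₁ (δ X) (P x) p (b x) (g n) ΔV ⟩
      4 * (P x * p * g n) * (δ X * b x * ΔV)  ≡⟨ cong (λ z → 4 * z * (δ X * b x * ΔV)) (g-cleared n) ⟩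
      4 * (A x * c n) * (δ X * b x * ΔV)      ≡⟨ regroup₂ (A x) (c n) (δ X) (b x) ΔV ⟩
      2 * c n * (2 * δ X * b x * A x * ΔV)    ≡⟨ cong (2 * c n *_) (V-increment n E≢0′) ⟩
      2 * c n * (γ X * P x)                   ≡⟨ *-comm (2 * c n) (γ X * P x) ⟩
      γ X * P x * (2 * c n)                   ≡⟨ cong (γ X * P x *_) (d-double n) ⟨
      γ X * P x * d (suc n)                   ≡⟨ cong (γ X * P x *_) (T-closed (suc n)) ⟨
      γ X * P x * (4 * p * T (suc n))         ≡⟨ regroup₃ (γ X) (P x) p (T (suc n)) ⟩
      P x * (4 * p) * (γ X * T (suc n))       ≡⟨ cong (P x * (4 * p) *_) (W-closed (suc n)) ⟨
      P x * (4 * p) * (δ X * W (suc n))       ≡⟨ regroup₄ (δ X) (P x) p (W (suc n)) ⟩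
      K * W (suc n)                           ∎)
    where
    x = ℕ→ℚ n
    X = ℕ→ℚ (suc n)
    p = 4 ^ℚ n
    ΔV = V (suc n) - V n
    K = δ X * (P x * (4 * p))
    K≢0 : K ≢ 0ℚ
    K≢0 = *-≢0 (δ≢0 (suc n)) (*-≢0 (P≢0 n) (^-≢0 (suc n) (ℕ→ℚ-suc≢0 3)))
    regroup₁ : ∀ δ P p β g v → δ * (P * (4 * p)) * (β * g * v) ≡ 4 * (P * p * g) * (δ * β * v)
    regroup₁ = solve-∀ ℚ-ring
    regroup₂ : ∀ A c δ β v → 4 * (A * c) * (δ * β * v) ≡ 2 * c * (2 * δ * β * A * v)
    regroup₂ = solve-∀ ℚ-ring
    regroup₃ : ∀ γ P p T → γ * P * (4 * p * T) ≡ P * (4 * p) * (γ * T)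
    regroup₃ = solve-∀ ℚ-ring
    regroup₄ : ∀ δ P p W → P * (4 * p) * (δ * W) ≡ δ * (P * (4 * p)) * W
    regroup₄ = solve-∀ ℚ-ring

  reciprocal-part : ∀ n → a (ℕ→ℚ n) * inv (1 + ℕ→ℚ (suc n)) + b (ℕ→ℚ n) * inv (1 + ℕ→ℚ n)
                          ≡ - (3 * (ℕ→ℚ n + 1))
  reciprocal-part n = begin
      a x * inv (1 + ℕ→ℚ (suc n)) + b x * inv (1 + x)
    ≡⟨ cong₂ (λ u v → a x * inv u + v * inv (1 + x)) (trans (cong (λ z → 1 + z) (ℕ→ℚ-suc n)) (shift x)) (factor x) ⟩
      2 * x * (2 - 3 * x) * (x + 2) * inv (x + 2) + - ((3 * x + 1) * (3 - 2 * x)) * (1 + x) * inv (1 + x)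
    ≡⟨ cong₂ _+_ (*-inv-cancelʳ (2 * x * (2 - 3 * x)) (ℕ→ℚ-+suc≢0 n 1))
                 (*-inv-cancelʳ (- ((3 * x + 1) * (3 - 2 * x))) 1+x≢0) ⟩
      2 * x * (2 - 3 * x) + - ((3 * x + 1) * (3 - 2 * x))
    ≡⟨ collect x ⟩
      - (3 * (x + 1))
    ∎
    where
    x = ℕ→ℚ n
    1+x≢0 : 1 + x ≢ 0ℚ
    1+x≢0 eq = ℕ→ℚ-suc≢0 n (trans (ℕ→ℚ-suc n) (trans (+-comm x 1) eq))
    shift : ∀ x → 1 + (x + 1) ≡ x + 2
    shift = solve-∀ ℚ-ring
    factor : ∀ x → - ((x + 1) * (3 * x + 1) * (3 - 2 * x)) ≡ - ((3 * x + 1) * (3 - 2 * x)) * (1 + x)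
    factor = solve-∀ ℚ-ring
    collect : ∀ x → 2 * x * (2 - 3 * x) + - ((3 * x + 1) * (3 - 2 * x)) ≡ - (3 * (x + 1))
    collect = solve-∀ ℚ-ring

  closed-recurrence : ∀ n → E (ℕ→ℚ n) ≢ 0ℚ →
                      a (ℕ→ℚ n) * closed (suc n) + b (ℕ→ℚ n) * closed n ≡ 3 * (ℕ→ℚ n + 1) - W (suc n)
  closed-recurrence n E≢0′ = begin
      a x * (g (suc n) * V (suc n) - i₁) + b x * (g n * V n - i₀)
    ≡⟨ regroup (a x) (b x) (g (suc n)) (g n) (V (suc n)) (V n) i₁ i₀ ⟩
      a x * g (suc n) * V (suc n) + b x * g n * V n - (a x * i₁ + b x * i₀)
    ≡⟨ cong₂ (λ α β → α * V (suc n) + b x * g n * V n - β) (g-recurrence n) (reciprocal-part n) ⟩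
      - (b x * g n) * V (suc n) + b x * g n * V n - - (3 * (x + 1))
    ≡⟨ regroup′ (b x * g n) (V (suc n)) (V n) (3 * (x + 1)) ⟩
      3 * (x + 1) - b x * g n * (V (suc n) - V n)
    ≡⟨ cong (λ z → 3 * (x + 1) - z) (variation-of-constants n E≢0′) ⟩
      3 * (x + 1) - W (suc n)
    ∎
    where
    x = ℕ→ℚ n
    i₀ = inv (1 + x)
    i₁ = inv (1 + ℕ→ℚ (suc n))
    regroup : ∀ α β g₁ g₀ v₁ v₀ i₁ i₀ → α * (g₁ * v₁ - i₁) + β * (g₀ * v₀ - i₀)
                                      ≡ α * g₁ * v₁ + β * g₀ * v₀ - (α * i₁ + β * i₀)
    regroup = solve-∀ ℚ-ring
    regroup′ : ∀ w v₁ v₀ r → - w * v₁ + w * v₀ - - r ≡ r - w * (v₁ - v₀)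
    regroup′ = solve-∀ ℚ-ring

  first-order-unique : ∀ (α β f y z : ℕ → ℚ) → (∀ n → α n ≢ 0ℚ) →
                       (∀ n → α n * y (suc n) + β n * y n ≡ f n) →
                       (∀ n → α n * z (suc n) + β n * z n ≡ f n) →
                       y 0 ≡ z 0 → ∀ n → y n ≡ z n
  first-order-unique α β f y z α≢0 y-rec z-rec y₀≡z₀ zero    = y₀≡z₀
  first-order-unique α β f y z α≢0 y-rec z-rec y₀≡z₀ (suc n) = *-cancelˡ (α≢0 n) (begin
      α n * y (suc n)     ≡⟨ ≡-sub (y-rec n) ⟩
      f n - β n * y n     ≡⟨ cong (λ w → f n - β n * w) (first-order-unique α β f y z α≢0 y-rec z-rec y₀≡z₀ n) ⟩
      f n - β n * z n     ≡⟨ ≡-sub (z-rec n) ⟨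
      α n * z (suc n)     ∎)

  -- E 0 = 0, so closed 0 involves inv 0ℚ = 0ℚ; the comparison starts at n = 1.
  s≡closed : ∀ n → s (suc n) ≡ closed (suc n)
  s≡closed =
    first-order-unique (λ k → a (ℕ→ℚ (suc k))) (λ k → b (ℕ→ℚ (suc k)))
                       (λ k → 3 * (ℕ→ℚ (suc k) + 1) - W (suc (suc k)))
                       (λ k → s (suc k)) (λ k → closed (suc k))
                       a≢0 (λ k → s-recurrence (suc k)) (λ k → closed-recurrence (suc k) (E≢0 k)) refl

theorem12 : (n : ℕ) → .{{_ : NonZero n}} →
    Σ[0≤k≤ n ] (λ k → ((-[1+ 0 ] / 4) ^ℚ k) * ℕ→ℚ (n C k) * ℕ→ℚ ((1 Data.Nat.+ 2 Data.Nat.* k) C k) * (ℕ→ℚ k * ℕ→ℚ k) * H (1 Data.Nat.+ 2 Data.Nat.* k))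
    ≡ (ℕ→ℚ 3 * ℕ→ℚ n * (ℕ→ℚ 2 - ℕ→ℚ 3 * ℕ→ℚ n))
        * inv ((ℕ→ℚ 3 - ℕ→ℚ 2 * ℕ→ℚ n) * (ℕ→ℚ 1 - ℕ→ℚ 4 * (ℕ→ℚ n * ℕ→ℚ n)) * (ℕ→ℚ 4 ^ℚ n))
        * ℕ→ℚ ((1 Data.Nat.+ 2 Data.Nat.* n) C n)
        * ( ℕ→ℚ 2 * H (1 Data.Nat.+ 2 Data.Nat.* n)
            - (+ 3 / 2) * H n
            - (ℕ→ℚ 3 - ℕ→ℚ 8 * ℕ→ℚ n - ℕ→ℚ 12 * (ℕ→ℚ n * ℕ→ℚ n)) * inv (ℕ→ℚ 1 - ℕ→ℚ 4 * (ℕ→ℚ n * ℕ→ℚ n))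
            + (ℕ→ℚ 9 + ℕ→ℚ n * (ℕ→ℚ 3 - ℕ→ℚ 25 * ℕ→ℚ n + ℕ→ℚ 6 * (ℕ→ℚ n * ℕ→ℚ n)))
                * inv (ℕ→ℚ 3 * ℕ→ℚ n * (ℕ→ℚ 3 - ℕ→ℚ 2 * ℕ→ℚ n) * (ℕ→ℚ 2 - ℕ→ℚ 3 * ℕ→ℚ n)) )
      - inv (ℕ→ℚ 1 + ℕ→ℚ n)
theorem12 zero {{n≢0}} = ⊥-elim-irr (NonZero.nonZero n≢0)
theorem12 (suc m) = s≡closed m
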